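{- Let $k\ge 3$ and $n\ge 1$ be integers, and let $c:\mathbb{Z}_n\to\{0,1\}$ be a 2-coloring with $A=c^{ -1}(0)$, $B=c^{ -1}(1)$, $|A|=\alpha n$. For $1\le i\le k$, let $A_i$ (resp. $B_i$) be the set of pairs $(a,d)\in\mathbb{Z}_n^2$ such that the $i$-th term $a+(i-1)d$ of the $k$-AP $(a,a+d,\dots,a+(k-1)d)$ lies in $A$ (resp. $B$). Let $1\le i<j\le k$. If $\gcd(j-i,n)=1$, then \[|A_i\cap A_j|=\alpha^2n^2,\qquad |B_i\cap B_j|=(1-\alpha)^2n^2.\] If $\gcd(j-i,n)\ne 1$, then \[|A_i\cap A_j|\ge\alpha^2n^2,\qquad |B_i\cap B_j|\ge(1-\alpha)^2n^2.\] -}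

module Defs where

open import Data.Nat using (ℕ; zero; suc; _+_; _*_; _∸_; NonZero)
open import Data.Nat.DivMod using (_mod_)
open import Data.Fin using (Fin; toℕ)
open import Data.Bool using (Bool; true; false; _∧_; if_then_else_)
open import Relation.Nullary.Decidable using (isYes)
import Data.Fin as F
import Data.Fin.Properties as FP

count : (n : ℕ) → (Fin n → Bool) → ℕ
count zero    p = 0
count (suc n) p = (if p F.zero then 1 else 0) + count n (λ x → p (F.suc x))

sumFin : (m : ℕ) → (Fin m → ℕ) → ℕ
sumFin zero    f = 0
sumFin (suc m) f = f F.zero + sumFin m (λ x → f (F.suc x))

count₂ : (n : ℕ) → (Fin n → Fin n → Bool) → ℕ
count₂ n p = sumFin n (λ a → count n (p a))

term : (n : ℕ) → .{{_ : NonZero n}} → Fin n → Fin n → ℕ → Fin n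
term n a d i = (toℕ a + (i ∸ 1) * toℕ d) mod n

hasColour : {n : ℕ} → (Fin n → Fin 2) → Fin 2 → Fin n → Bool
hasColour c col x = isYes (c x FP.≟ col)

classSize : (n : ℕ) → (Fin n → Fin 2) → Fin 2 → ℕ
classSize n c col = count n (hasColour c col)

-- |X_i ∩ X_j| where X_i = {(a,d) : c(a+(i-1)d) = col}  (X = A for col = 0, X = B for col = 1)
inter : (n : ℕ) → .{{_ : NonZero n}} → (Fin n → Fin 2) → Fin 2 → ℕ → ℕ → ℕ
inter n c col i j =
  count₂ n (λ a d → hasColour c col (term n a d i) ∧ hasColour c col (term n a d j))

-- Write F for the indicator of a colour class, viewed as an n-periodic
-- function on ℕ, s = i - 1 and m = j - i.  Then
--   |X_i ∩ X_j| = Σ_a Σ_d F(a + s d) F(a + (s + m) d) = Σ_x F(x) R(x),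
--   where the ray R(x) = Σ_d F(x + m d) is the mass of F along the
--   progression of step m through x
-- (substitute x = a + s d for fixed d, using periodicity).  We call the
-- right-hand side the correlation of F at step m.
--   * If gcd(m, n) = 1 then d ↦ x + m d is a bijection of ℤ_n, so R(x) = |X|
--     for every x and the correlation is exactly |X|².
--   * In general Σ_x R(x) = n |X| and Σ_x R(x)² = n · correlation (R is
--     invariant under x ↦ x + m), so Cauchy–Schwarz gives |X|² ≤ correlation.
module Submission where

open import Defs
open import Data.Nat using (ℕ; _*_; _≤_; _<_; _∸_; NonZero)
open import Data.Nat.GCD using (gcd)
open import Data.Fin using (Fin)
open import Data.Product using (_×_)
open import Relation.Binary.PropositionalEquality using (_≡_; _≢_)

open import Data.Nat using (zero; suc; _+_; z≤n; s≤s; _%_; _/_)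
open import Data.Nat.Properties
open import Data.Nat.DivMod using (_mod_; [m+n]%n≡m%n; m≡m%n+[m/n]*n; m<n⇒m%n≡m)
open import Data.Nat.Divisibility using (_∣_; divides; n∣m⇒m%n≡0)
open import Data.Nat.Coprimality using (Coprime; coprime-divisor; gcd≡1⇒coprime) renaming (sym to coprime-sym)
open import Data.Nat.Tactic.RingSolver using (solve-∀)
open import Data.Fin using (toℕ; punchOut)
import Data.Fin.Properties as FinP
open import Data.Fin.Permutation using (permutation)
open import Data.Bool using (Bool; true; false; _∧_; if_then_else_)
open import Data.Product using (_,_; proj₁; proj₂; ∃)
open import Data.Sum using (inj₁; inj₂)
open import Function.Definitions using (Injective)
open import Relation.Nullary using (yes; no)
open import Relation.Nullary.Negation using (contradiction)
open import Relation.Binary.PropositionalEquality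
  using (refl; cong; cong₂; sym; trans; subst₂; module ≡-Reasoning)
open import Algebra.Properties.Semiring.Sum +-*-semiring
  using (sum; sum-syntax; sum-cong-≗; ∑-comm; ∑-distrib-+; *-distribˡ-sum; *-distribʳ-sum; ∑-permute)
open import Algebra.Properties.CommutativeSemigroup +-commutativeSemigroup
  using () renaming (xy∙z≈xz∙y to +-swapʳ)

sumFin≡∑ : ∀ n (f : Fin n → ℕ) → sumFin n f ≡ ∑[ x < n ] f x
sumFin≡∑ zero    f = refl
sumFin≡∑ (suc n) f = cong (f Fin.zero +_) (sumFin≡∑ n (λ x → f (Fin.suc x)))

𝟙 : Bool → ℕ
𝟙 b = if b then 1 else 0

𝟙-∧ : ∀ a b → 𝟙 (a ∧ b) ≡ 𝟙 a * 𝟙 b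
𝟙-∧ true  b = sym (+-identityʳ (𝟙 b))
𝟙-∧ false b = refl

count≡∑ : ∀ n (p : Fin n → Bool) → count n p ≡ ∑[ x < n ] 𝟙 (p x)
count≡∑ zero    p = refl
count≡∑ (suc n) p = cong (𝟙 (p Fin.zero) +_) (count≡∑ n (λ x → p (Fin.suc x)))

∑-const : ∀ n k → ∑[ x < n ] k ≡ n * k
∑-const zero    k = refl
∑-const (suc n) k = cong (k +_) (∑-const n k)

∑-mono-≤ : ∀ n {f g : Fin n → ℕ} → (∀ x → f x ≤ g x) → ∑[ x < n ] f x ≤ ∑[ x < n ] g x
∑-mono-≤ zero    f≤g = z≤n
∑-mono-≤ (suc n) f≤g = +-mono-≤ (f≤g Fin.zero) (∑-mono-≤ n (λ x → f≤g (Fin.suc x)))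

∑-square : ∀ n (f : Fin n → ℕ) → ∑[ x < n ] f x * ∑[ y < n ] f y ≡ ∑[ x < n ] ∑[ y < n ] (f x * f y)
∑-square n f = trans (*-distribʳ-sum {n} (sum f) f) (sum-cong-≗ {n} (λ x → *-distribˡ-sum {n} (f x) f))

-- AM–GM for two naturals: writing b = a + k, 2a(a+k) + k² = a² + (a+k)².
am-gm-≤ : ∀ {a b} → a ≤ b → 2 * (a * b) ≤ a * a + b * b
am-gm-≤ {a} a≤b with k , refl ← m≤n⇒∃[o]m+o≡n a≤b = subst₂ _≤_ refl (expand a k) (m≤m+n _ (k * k))
  where
  expand : ∀ a k → 2 * (a * (a + k)) + k * k ≡ a * a + (a + k) * (a + k)
  expand = solve-∀

am-gm : ∀ a b → 2 * (a * b) ≤ a * a + b * b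
am-gm a b with ≤-total a b
... | inj₁ a≤b = am-gm-≤ a≤b
... | inj₂ b≤a = subst₂ _≤_ (cong (2 *_) (*-comm b a)) (+-comm (b * b) (a * a)) (am-gm-≤ b≤a)

-- Cauchy–Schwarz over ℕ, proved by summing AM–GM over all pairs (x, y).
cauchy-schwarz : ∀ n (f : Fin n → ℕ) →
                 ∑[ x < n ] f x * ∑[ x < n ] f x ≤ n * ∑[ x < n ] (f x * f x)
cauchy-schwarz n f = *-cancelˡ-≤ 2 (begin
    2 * (Σf * Σf)
  ≡⟨ cong (2 *_) (∑-square n f) ⟩
    2 * ∑[ x < n ] ∑[ y < n ] (f x * f y)
  ≡⟨ *-distribˡ-sum 2 (λ x → ∑[ y < n ] (f x * f y)) ⟩
    ∑[ x < n ] (2 * ∑[ y < n ] (f x * f y))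
  ≡⟨ sum-cong-≗ {n} (λ x → *-distribˡ-sum 2 (λ y → f x * f y)) ⟩
    ∑[ x < n ] ∑[ y < n ] (2 * (f x * f y))
  ≤⟨ ∑-mono-≤ n (λ x → ∑-mono-≤ n (λ y → am-gm (f x) (f y))) ⟩
    ∑[ x < n ] ∑[ y < n ] (f x * f x + f y * f y)
  ≡⟨ sum-cong-≗ {n} (λ x → trans (∑-distrib-+ (λ _ → f x * f x) (λ y → f y * f y)) (cong (_+ Q) (∑-const n (f x * f x)))) ⟩
    ∑[ x < n ] (n * (f x * f x) + Q)
  ≡⟨ ∑-distrib-+ (λ x → n * (f x * f x)) (λ _ → Q) ⟩
    ∑[ x < n ] (n * (f x * f x)) + ∑[ x < n ] Q
  ≡⟨ cong₂ _+_ (sym (*-distribˡ-sum n (λ x → f x * f x))) (∑-const n Q) ⟩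
    n * Q + n * Q
  ≡⟨ cong (n * Q +_) (sym (+-identityʳ (n * Q))) ⟩
    2 * (n * Q) ∎)
  where
  open ≤-Reasoning
  Σf = ∑[ x < n ] f x
  Q  = ∑[ x < n ] (f x * f x)

∑< : ℕ → (ℕ → ℕ) → ℕ
∑< n G = ∑[ x < n ] G (toℕ x)

Periodic : ℕ → (ℕ → ℕ) → Set
Periodic n G = ∀ u → G (u + n) ≡ G u

periodic-* : ∀ {n G} → Periodic n G → ∀ u k → G (u + k * n) ≡ G u
periodic-* {G = G} per u zero = cong G (+-identityʳ u)
periodic-* {n} {G} per u (suc k) = begin
  G (u + (n + k * n)) ≡⟨ cong G (trans (cong (u +_) (+-comm n (k * n))) (sym (+-assoc u (k * n) n))) ⟩
  G (u + k * n + n)   ≡⟨ per (u + k * n) ⟩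
  G (u + k * n)       ≡⟨ periodic-* per u k ⟩
  G u                 ∎
  where open ≡-Reasoning

periodic-% : ∀ {n G} .{{_ : NonZero n}} → Periodic n G → ∀ u → G u ≡ G (u % n)
periodic-% {n} {G} per u = trans (cong G (m≡m%n+[m/n]*n u n)) (periodic-* per (u % n) (u / n))

∑<-step : ∀ n (G : ℕ → ℕ) → ∑< n (λ x → G (suc x)) + G 0 ≡ ∑< n G + G n
∑<-step zero    G = refl
∑<-step (suc n) G = begin
    G 1 + ∑< n (λ x → G (2 + x)) + G 0
  ≡⟨ +-comm _ (G 0) ⟩
    G 0 + (G 1 + ∑< n (λ x → G (2 + x)))
  ≡⟨ cong (G 0 +_) (+-comm (G 1) _) ⟩
    G 0 + (∑< n (λ x → G (2 + x)) + G 1)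
  ≡⟨ cong (G 0 +_) (∑<-step n (λ x → G (suc x))) ⟩
    G 0 + (∑< n (λ x → G (suc x)) + G (suc n))
  ≡⟨ sym (+-assoc (G 0) _ _) ⟩
    G 0 + ∑< n (λ x → G (suc x)) + G (suc n) ∎
  where open ≡-Reasoning

∑<-translate : ∀ {n G} → Periodic n G → ∀ t → ∑< n (λ x → G (t + x)) ≡ ∑< n G
∑<-translate per zero = refl
∑<-translate {n} {G} per (suc t) = begin
  ∑< n (λ x → G (suc t + x))  ≡⟨ ∑<-translate (λ u → per (suc u)) t ⟩
  ∑< n (λ x → G (suc x))      ≡⟨ +-cancelʳ-≡ (G 0) _ _ (trans (∑<-step n G) (cong (∑< n G +_) (per 0))) ⟩
  ∑< n G                      ∎
  where open ≡-Reasoning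

-- Pigeonhole: an injection Fin (suc n) → Fin (suc n) is onto, since missing a value y
-- would give an injection Fin (suc n) → Fin n after punching y out.
injective⇒onto : ∀ n (σ : Fin n → Fin n) → Injective _≡_ _≡_ σ → ∀ y → ∃ λ x → σ x ≡ y
injective⇒onto (suc n) σ σ-inj y with FinP.any? (λ x → σ x FinP.≟ y)
... | yes hit = hit
... | no miss = contradiction (FinP.injective⇒≤ punched-inj) 1+n≰n
  where
  y≢σ : ∀ x → y ≢ σ x
  y≢σ x y≡σx = miss (x , sym y≡σx)
  punched : Fin (suc n) → Fin n
  punched x = punchOut (y≢σ x)
  punched-inj : Injective _≡_ _≡_ punched
  punched-inj {x} {x'} eq = σ-inj (FinP.punchOut-injective (y≢σ x) (y≢σ x') eq)

∑-reindex : ∀ n (σ : Fin n → Fin n) → Injective _≡_ _≡_ σ → (g : Fin n → ℕ) →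
            ∑[ x < n ] g (σ x) ≡ ∑[ y < n ] g y
∑-reindex n σ σ-inj g = sym (∑-permute g (permutation σ σ⁻¹ σ∘σ⁻¹ σ⁻¹∘σ))
  where
  σ⁻¹ : Fin n → Fin n
  σ⁻¹ y = proj₁ (injective⇒onto n σ σ-inj y)
  σ∘σ⁻¹ : ∀ y → σ (σ⁻¹ y) ≡ y
  σ∘σ⁻¹ y = proj₂ (injective⇒onto n σ σ-inj y)
  σ⁻¹∘σ : ∀ x → σ⁻¹ (σ x) ≡ x
  σ⁻¹∘σ x = σ-inj (σ∘σ⁻¹ (σ x))

%-≡⇒∣∸ : ∀ n .{{_ : NonZero n}} u v → u % n ≡ v % n → n ∣ v ∸ u
%-≡⇒∣∸ n u v eq = divides (v / n ∸ u / n) (begin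
    v ∸ u
  ≡⟨ cong₂ _∸_ (m≡m%n+[m/n]*n v n) (m≡m%n+[m/n]*n u n) ⟩
    (v % n + v / n * n) ∸ (u % n + u / n * n)
  ≡⟨ cong (λ r → (v % n + v / n * n) ∸ (r + u / n * n)) eq ⟩
    (v % n + v / n * n) ∸ (v % n + u / n * n)
  ≡⟨ [m+n]∸[m+o]≡n∸o (v % n) _ _ ⟩
    v / n * n ∸ u / n * n
  ≡⟨ sym (*-distribʳ-∸ n (v / n) (u / n)) ⟩
    (v / n ∸ u / n) * n ∎)
  where open ≡-Reasoning

-- For m coprime to n, the progression d ↦ x + m d is injective modulo n
-- on 0 ≤ d < n: a difference m (b - a) with 0 ≤ b - a < n is divisible by n
-- only if b = a.
progression-%-injective : ∀ n .{{_ : NonZero n}} x m → Coprime n m → ∀ {a b} →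
                          a ≤ b → b < n → (x + m * a) % n ≡ (x + m * b) % n → a ≡ b
progression-%-injective n x m coprime {a} {b} a≤b b<n eq = ≤-antisym a≤b (m∸n≡0⇒m≤n (begin
    b ∸ a         ≡⟨ sym (m<n⇒m%n≡m (≤-<-trans (m∸n≤m b a) b<n)) ⟩
    (b ∸ a) % n   ≡⟨ n∣m⇒m%n≡0 (b ∸ a) n (coprime-divisor coprime n∣m[b∸a]) ⟩
    0             ∎))
  where
  open ≡-Reasoning
  n∣m[b∸a] : n ∣ m * (b ∸ a)
  n∣m[b∸a] = subst₂ _∣_ refl
    (trans ([m+n]∸[m+o]≡n∸o x (m * b) (m * a)) (sym (*-distribˡ-∸ m b a)))
    (%-≡⇒∣∸ n _ _ eq)

mod⇒% : ∀ n .{{_ : NonZero n}} u v → u mod n ≡ v mod n → u % n ≡ v % n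
mod⇒% n u v eq = trans (sym (FinP.toℕ-fromℕ< _)) (trans (cong toℕ eq) (FinP.toℕ-fromℕ< _))

progression-mod-injective : ∀ n .{{_ : NonZero n}} x m → Coprime n m →
                            Injective _≡_ _≡_ (λ (d : Fin n) → (x + m * toℕ d) mod n)
progression-mod-injective n x m coprime {a} {b} eq with ≤-total (toℕ a) (toℕ b)
... | inj₁ a≤b = FinP.toℕ-injective
  (progression-%-injective n x m coprime a≤b (FinP.toℕ<n b) (mod⇒% n _ _ eq))
... | inj₂ b≤a = sym (FinP.toℕ-injective
  (progression-%-injective n x m coprime b≤a (FinP.toℕ<n a) (mod⇒% n _ _ (sym eq))))

module Correlation (n : ℕ) .{{_ : NonZero n}} (F : ℕ → ℕ) (F-periodic : Periodic n F) where

  mass : ℕ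
  mass = ∑< n F

  ray : ℕ → ℕ → ℕ
  ray m x = ∑< n (λ d → F (x + m * d))

  correlation : ℕ → ℕ
  correlation m = ∑< n (λ x → F x * ray m x)

  progression-periodic : ∀ x m → Periodic n (λ d → F (x + m * d))
  progression-periodic x m d = trans (cong F (expand x m d n)) (periodic-* F-periodic (x + m * d) m)
    where
    expand : ∀ x m d n → x + m * (d + n) ≡ x + m * d + m * n
    expand = solve-∀

  shifted-product-periodic : ∀ y → Periodic n (λ x → F x * F (x + y))
  shifted-product-periodic y x =
    cong₂ _*_ (F-periodic x) (trans (cong F (+-swapʳ x n y)) (F-periodic (x + y)))

  ray-periodic : ∀ m → Periodic n (ray m)
  ray-periodic m x =
    sum-cong-≗ {n} (λ d → trans (cong F (+-swapʳ x n (m * toℕ d))) (F-periodic (x + m * toℕ d)))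

  ray-invariant : ∀ m t x → ray m (m * t + x) ≡ ray m x
  ray-invariant m t x = trans (sum-cong-≗ {n} (λ d → cong F (regroup m t x (toℕ d))))
                              (∑<-translate (progression-periodic x m) t)
    where
    regroup : ∀ m t x d → m * t + x + m * d ≡ x + m * (t + d)
    regroup = solve-∀

  -- Each shift of F has total mass `mass`, so the rays carry n · mass in total.
  ∑-ray : ∀ m → ∑< n (ray m) ≡ n * mass
  ∑-ray m = begin
      ∑[ x < n ] ∑[ d < n ] F (toℕ x + m * toℕ d)
    ≡⟨ ∑-comm {n} {n} (λ x d → F (toℕ x + m * toℕ d)) ⟩
      ∑[ d < n ] ∑[ x < n ] F (toℕ x + m * toℕ d)
    ≡⟨ sum-cong-≗ {n} (λ d → trans (sum-cong-≗ {n} (λ x → cong F (+-comm (toℕ x) (m * toℕ d))))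
                                (∑<-translate F-periodic (m * toℕ d))) ⟩
      ∑[ d < n ] mass
    ≡⟨ ∑-const n mass ⟩
      n * mass ∎
    where open ≡-Reasoning

  -- Weighting the rays by a shift F(x + m t) instead of F(x) gives the same
  -- correlation: translate x by m t and use the invariance of rays.
  shifted-correlation : ∀ m t → ∑< n (λ x → F (x + m * t) * ray m x) ≡ correlation m
  shifted-correlation m t = begin
      ∑< n (λ x → F (x + m * t) * ray m x)
    ≡⟨ sum-cong-≗ {n} (λ x → cong₂ _*_ (cong F (+-comm (toℕ x) (m * t))) (sym (ray-invariant m t (toℕ x)))) ⟩
      ∑< n (λ x → F (m * t + x) * ray m (m * t + x))
    ≡⟨ ∑<-translate {G = λ x → F x * ray m x} (λ x → cong₂ _*_ (F-periodic x) (ray-periodic m x)) (m * t) ⟩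
      correlation m ∎
    where open ≡-Reasoning

  ∑-ray² : ∀ m → ∑< n (λ x → ray m x * ray m x) ≡ n * correlation m
  ∑-ray² m = begin
      ∑[ x < n ] (ray m (toℕ x) * ray m (toℕ x))
    ≡⟨ sum-cong-≗ {n} (λ x → *-distribʳ-sum {n} (ray m (toℕ x)) (λ d → F (toℕ x + m * toℕ d))) ⟩
      ∑[ x < n ] ∑[ d < n ] (F (toℕ x + m * toℕ d) * ray m (toℕ x))
    ≡⟨ ∑-comm {n} {n} (λ x d → F (toℕ x + m * toℕ d) * ray m (toℕ x)) ⟩
      ∑[ d < n ] ∑[ x < n ] (F (toℕ x + m * toℕ d) * ray m (toℕ x))
    ≡⟨ sum-cong-≗ {n} (λ d → shifted-correlation m (toℕ d)) ⟩
      ∑[ d < n ] correlation m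
    ≡⟨ ∑-const n (correlation m) ⟩
      n * correlation m ∎
    where open ≡-Reasoning

  -- Cauchy–Schwarz applied to the rays: (n · mass)² ≤ n · n · correlation.
  mass²≤correlation : ∀ m → mass * mass ≤ correlation m
  mass²≤correlation m = *-cancelˡ-≤ n (*-cancelˡ-≤ n (begin
      n * (n * (mass * mass))
    ≡⟨ regroup n mass ⟩
      (n * mass) * (n * mass)
    ≡⟨ sym (cong₂ _*_ (∑-ray m) (∑-ray m)) ⟩
      ∑< n (ray m) * ∑< n (ray m)
    ≤⟨ cauchy-schwarz n (λ x → ray m (toℕ x)) ⟩
      n * ∑< n (λ x → ray m x * ray m x)
    ≡⟨ cong (n *_) (∑-ray² m) ⟩
      n * (n * correlation m) ∎))
    where
    open ≤-Reasoning
    regroup : ∀ a b → a * (a * (b * b)) ≡ (a * b) * (a * b)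
    regroup = solve-∀

  -- The correlation of the pair of AP terms with indices s + 1 and s + m + 1:
  -- substituting x = a + s d for each fixed d removes s.
  pair-correlation : ∀ s m → ∑< n (λ a → ∑< n (λ d → F (a + s * d) * F (a + (s + m) * d))) ≡ correlation m
  pair-correlation s m = begin
      ∑[ a < n ] ∑[ d < n ] (F (toℕ a + s * toℕ d) * F (toℕ a + (s + m) * toℕ d))
    ≡⟨ ∑-comm {n} {n} (λ a d → F (toℕ a + s * toℕ d) * F (toℕ a + (s + m) * toℕ d)) ⟩
      ∑[ d < n ] ∑[ a < n ] (F (toℕ a + s * toℕ d) * F (toℕ a + (s + m) * toℕ d))
    ≡⟨ sum-cong-≗ {n} (λ d → substitute (toℕ d)) ⟩
      ∑[ d < n ] ∑[ x < n ] (F (toℕ x) * F (toℕ x + m * toℕ d))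
    ≡⟨ ∑-comm {n} {n} (λ x d → F (toℕ x) * F (toℕ x + m * toℕ d)) ⟨
      ∑[ x < n ] ∑[ d < n ] (F (toℕ x) * F (toℕ x + m * toℕ d))
    ≡⟨ sum-cong-≗ {n} (λ x → *-distribˡ-sum {n} (F (toℕ x)) (λ d → F (toℕ x + m * toℕ d))) ⟨
      correlation m ∎
    where
    open ≡-Reasoning
    regroup : ∀ a s m d → a + (s + m) * d ≡ s * d + a + m * d
    regroup = solve-∀
    substitute : ∀ d → ∑< n (λ a → F (a + s * d) * F (a + (s + m) * d)) ≡ ∑< n (λ x → F x * F (x + m * d))
    substitute d = trans
      (sum-cong-≗ {n} (λ a → cong₂ _*_ (cong F (+-comm (toℕ a) (s * d))) (cong F (regroup (toℕ a) s m d))))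
      (∑<-translate (shifted-product-periodic (m * d)) (s * d))

  -- For m coprime to n every ray visits each residue exactly once.
  ray-coprime : ∀ m → Coprime n m → ∀ x → ray m x ≡ mass
  ray-coprime m coprime x = begin
      ∑[ d < n ] F (x + m * toℕ d)
    ≡⟨ sum-cong-≗ {n} (λ d → trans (periodic-% F-periodic (x + m * toℕ d)) (cong F (sym (FinP.toℕ-fromℕ< _)))) ⟩
      ∑[ d < n ] F (toℕ ((x + m * toℕ d) mod n))
    ≡⟨ ∑-reindex n (λ d → (x + m * toℕ d) mod n) (progression-mod-injective n x m coprime) (λ y → F (toℕ y)) ⟩
      mass ∎
    where open ≡-Reasoning

  correlation-coprime : ∀ m → Coprime n m → correlation m ≡ mass * mass
  correlation-coprime m coprime = begin
      ∑[ x < n ] (F (toℕ x) * ray m (toℕ x))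
    ≡⟨ sum-cong-≗ {n} (λ x → cong (F (toℕ x) *_) (ray-coprime m coprime (toℕ x))) ⟩
      ∑[ x < n ] (F (toℕ x) * mass)
    ≡⟨ *-distribʳ-sum {n} mass (λ x → F (toℕ x)) ⟨
      mass * mass ∎
    where open ≡-Reasoning

∸-split : ∀ {i j} → 1 ≤ i → i ≤ j → j ∸ 1 ≡ (i ∸ 1) + (j ∸ i)
∸-split {suc i} {suc j} _ (s≤s i≤j) = sym (m+[n∸m]≡n i≤j)

module ColourClass (n : ℕ) .{{_ : NonZero n}} (c : Fin n → Fin 2) (col : Fin 2) where

  inClass : ℕ → ℕ
  inClass u = 𝟙 (hasColour c col (u mod n))

  inClass-periodic : Periodic n inClass
  inClass-periodic u = cong (λ y → 𝟙 (hasColour c col y)) (FinP.fromℕ<-cong _ _ ([m+n]%n≡m%n u n) _ _)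

  open Correlation n inClass inClass-periodic public

  toℕ-mod : ∀ (x : Fin n) → toℕ x mod n ≡ x
  toℕ-mod x = trans (FinP.fromℕ<-cong _ _ (m<n⇒m%n≡m (FinP.toℕ<n x)) _ _) (FinP.fromℕ<-toℕ x (FinP.toℕ<n x))

  classSize≡mass : classSize n c col ≡ mass
  classSize≡mass = trans (count≡∑ n (hasColour c col))
    (sum-cong-≗ {n} (λ x → cong (λ y → 𝟙 (hasColour c col y)) (sym (toℕ-mod x))))

  inter≡correlation : ∀ i j → 1 ≤ i → i < j → inter n c col i j ≡ correlation (j ∸ i)
  inter≡correlation i j 1≤i i<j = begin
      inter n c col i j
    ≡⟨ trans (sumFin≡∑ n _) (sum-cong-≗ {n} (λ a → trans (count≡∑ n _) (sum-cong-≗ {n} (λ d →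
         𝟙-∧ (hasColour c col (term n a d i)) (hasColour c col (term n a d j)))))) ⟩
      ∑< n (λ a → ∑< n (λ d → inClass (a + (i ∸ 1) * d) * inClass (a + (j ∸ 1) * d)))
    ≡⟨ cong (λ t → ∑< n (λ a → ∑< n (λ d → inClass (a + (i ∸ 1) * d) * inClass (a + t * d))))
            (∸-split 1≤i (<⇒≤ i<j)) ⟩
      ∑< n (λ a → ∑< n (λ d → inClass (a + (i ∸ 1) * d) * inClass (a + ((i ∸ 1) + (j ∸ i)) * d)))
    ≡⟨ pair-correlation (i ∸ 1) (j ∸ i) ⟩
      correlation (j ∸ i) ∎
    where open ≡-Reasoning

lemma2 : (k n : ℕ) → .{{_ : NonZero n}} → 3 ≤ k → 1 ≤ n →
    (c : Fin n → Fin 2) → (i j : ℕ) → 1 ≤ i → i < j → j ≤ k →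
    (gcd (j ∸ i) n ≡ 1 →
    (inter n c Fin.zero i j ≡ classSize n c Fin.zero * classSize n c Fin.zero)
    × (inter n c (Fin.suc Fin.zero) i j ≡ classSize n c (Fin.suc Fin.zero) * classSize n c (Fin.suc Fin.zero)))
    × (gcd (j ∸ i) n ≢ 1 →
    (classSize n c Fin.zero * classSize n c Fin.zero ≤ inter n c Fin.zero i j)
    × (classSize n c (Fin.suc Fin.zero) * classSize n c (Fin.suc Fin.zero) ≤ inter n c (Fin.suc Fin.zero) i j))
lemma2 k n 3≤k 1≤n c i j 1≤i i<j j≤k =
    (λ gcd≡1 → exact Fin.zero gcd≡1 , exact (Fin.suc Fin.zero) gcd≡1)
  , (λ _ → lower Fin.zero , lower (Fin.suc Fin.zero))
  where
  exact : ∀ col → gcd (j ∸ i) n ≡ 1 → inter n c col i j ≡ classSize n c col * classSize n c col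
  exact col gcd≡1 = begin
      inter n c col i j    ≡⟨ inter≡correlation i j 1≤i i<j ⟩
      correlation (j ∸ i)  ≡⟨ correlation-coprime (j ∸ i) (coprime-sym (gcd≡1⇒coprime gcd≡1)) ⟩
      mass * mass          ≡⟨ sym (cong₂ _*_ classSize≡mass classSize≡mass) ⟩
      classSize n c col * classSize n c col ∎
    where
    open ColourClass n c col
    open ≡-Reasoning

  lower : ∀ col → classSize n c col * classSize n c col ≤ inter n c col i j
  lower col = subst₂ _≤_ (sym (cong₂ _*_ classSize≡mass classSize≡mass)) (sym (inter≡correlation i j 1≤i i<j))
                         (mass²≤correlation (j ∸ i))
    where open ColourClass n c col
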